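{- Let $k\ge 2$ and let $w_n$ be the number of weak-ordering chains in $\mathcal{WOC}(n)$ subject to the stopping condition $x_{i_1}=\cdots=x_{i_k}$ (with distinct indices). Let $a_n$ be the number of chains in $\mathcal{WOC}(n)$ not containing this condition, i.e. the number of ordered set partitions of $[n]$ all of whose blocks have size at most $k-1$ (with $a_0=1$). Then $w_i=f_i$ for $1\le i<k$, where $f_i$ is the $i$-th Fubini number, and for $n\ge k$, \[ w_n=\sum_{i=1}^{k-1}\binom{n}{i}a_{n-i}+\sum_{j=k}^{n}\binom{j-1}{k-1}\sum_{i=0}^{j-k}\binom{j-k}{i}a_ia_{j-k-i}. \]
   Context: A weak-ordering chain on $x_1,\dots,x_m$ is an expression $x_{i_1}\,\mathrm{op}\,x_{i_2}\,\mathrm{op}\cdots\mathrm{op}\,x_{i_m}$, where $(i_1,\dots,i_m)$ is an ordering of $[m]$ and each $\mathrm{op}$ is $<$ or $=$; expressions defining the same ordered set partition of $[m]$ (blocks = index sets of equal variables) are identified. $\mathcal{WOC}(m)$ is the set of these chains; $|\mathcal{WOC}(m)|=f_m$, the Fubini (ordered Bell) numbers $1,1,3,13,75,\dots$ given by $f_0=1$, $f_m=\sum_{i=1}^m\binom{m}{i}f_{m-i}$. Each chain in $\mathcal{WOC}(m)$, $m\ge 2$, arises uniquely from its restriction to $x_1,\dots,x_{m-1}$ by inserting $x_m$; this gives a rooted tree with root $x_1$ whose level-$m$ nodes are the elements of $\mathcal{WOC}(m)$. The restricted generating tree of order $n$ for a stopping condition is the part of this tree up to level $n$ in which any node containing the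 stopping condition has no descendants; "the number of weak-ordering chains in $\mathcal{WOC}(n)$ subject to the stopping condition" is the number of leaves of this tree (nodes at level $n$ plus nodes containing the condition), equivalently the number of chains in $\mathcal{WOC}(n)$ avoiding the condition plus, for each $j\le n$, the number of chains in $\mathcal{WOC}(j)$ containing the condition whose restriction to $x_1,\dots,x_{j-1}$ avoids it. Here a chain contains the stopping condition if some $k$ distinct variables are all equal in it (some block of the partition has size $\ge k$). -}

module Defs where

open import Data.Nat using (ℕ; zero; suc; _+_; _*_; _∸_; _≤_; _<_; _≟_; _<?_)
open import Data.Nat.Combinatorics using (_C_)
open import Data.List using (List; []; _∷_; length; map; filter; deduplicate; take; upTo)
open import Data.Nat.ListAction using (sum)
open import Data.List.Membership.Propositional using (_∈_)
open import Data.List.Relation.Unary.Unique.Propositional using (Unique)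
open import Data.Product using (Σ; _×_)
open import Data.Sum using (_⊎_)
open import Relation.Nullary using (¬_)
open import Relation.Binary.PropositionalEquality using (_≡_)
open import Function.Bundles using (_⇔_)

-- A weak-ordering chain on x_1..x_m (= ordered set partition of [m]) is
-- encoded canonically by its rank list r = (r_1,...,r_m): r_i is the index
-- (0-based) of the block containing x_i; the set of values occurring must be
-- an initial segment {0,...,b-1} of ℕ.  x_i = x_j iff r_i = r_j,
-- x_i < x_j iff r_i < r_j.
WOC : ℕ → List ℕ → Set
WOC m r = length r ≡ m × (∀ {c} → c ∈ r → ∀ {d} → d < c → d ∈ r)

blockSize : ℕ → List ℕ → ℕ
blockSize c r = length (filter (c ≟_) r)

-- the chain contains the stopping condition: k distinct variables all equal,
-- i.e. some block has size ≥ k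
Contains : ℕ → List ℕ → Set
Contains k r = Σ ℕ (λ c → k ≤ blockSize c r)

-- re-rank a list of values so that the values form an initial segment
normalize : List ℕ → List ℕ
normalize xs = map (λ v → length (deduplicate _≟_ (filter (_<? v) xs))) xs

restrict : List ℕ → List ℕ
restrict r = normalize (take (length r ∸ 1) r)

-- leaves of the restricted generating tree of order n (levels 1..n)
Leaf : ℕ → ℕ → List ℕ → Set
Leaf k n r =
  (WOC n r × ¬ Contains k r)
  ⊎ Σ ℕ (λ j → 1 ≤ j × j ≤ n × WOC j r × Contains k r × ¬ Contains k (restrict r))

Avoid : ℕ → ℕ → List ℕ → Set
Avoid k m r = WOC m r × ¬ Contains k r

Card : (List ℕ → Set) → ℕ → Set
Card P N = Σ (List (List ℕ)) (λ L → Unique L × (∀ r → (r ∈ L) ⇔ P r) × length L ≡ N)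

-- Fubini numbers: f_0 = 1, f_m = Σ_{i=1}^m C(m,i) f_{m-i}
-- fubiniList m = [f_m, f_{m-1}, ..., f_0]
fubiniStep : ℕ → ℕ → List ℕ → ℕ   -- fubiniStep M i [x_0,x_1,...] = Σ_t C(M,i+t) x_t
fubiniStep M i [] = 0
fubiniStep M i (x ∷ xs) = (M C i) * x + fubiniStep M (suc i) xs

fubiniList : ℕ → List ℕ
fubiniList zero = 1 ∷ []
fubiniList (suc m) = fubiniStep (suc m) 1 (fubiniList m) ∷ fubiniList m

fubini : ℕ → ℕ
fubini m with fubiniList m
... | [] = 0
... | x ∷ _ = x

-- Σ_{i=lo}^{hi} f i  (0 if hi < lo)
sumFromTo : ℕ → ℕ → (ℕ → ℕ) → ℕ
sumFromTo lo hi f = sum (map (λ t → f (lo + t)) (upTo (suc hi ∸ lo)))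

-- An avoiding chain on n ≥ 1 variables is determined by the positions of its lowest
-- block, of some size 1 ≤ i < k, together with the avoiding chain formed by the other
-- n − i variables; hence a_n = Σ_{i=1}^{k−1} C(n,i) a_{n−i}, which for n < k (where
-- every chain avoids the condition) is the Fubini recurrence.  A leaf at level n is either
-- an avoiding chain in WOC(n) or a chain in WOC(j), j ≤ n, in which x_j completes a block
-- of exactly k equal variables.  Such a chain is determined by the positions of the other
-- k − 1 members of that block among x_1, …, x_{j−1}, and by the way the remaining j − k
-- variables split into those below and those above the block: these form two independent
-- avoiding chains, giving C(j−1,k−1) Σ_i C(j−k,i) a_i a_{j−k−i}.  Each of these
-- decompositions is a bijection onto Boolean masks (counted by binomial coefficients)
-- paired with smaller avoiding chains.

module Submission where

open import Defs
open import Data.Nat using (ℕ; zero; suc; _+_; _*_; _∸_; _⊔_; _≤_; _<_; z≤n; s≤s; _≟_; _<?_)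
open import Algebra.Properties.CommutativeSemigroup using (x∙yz≈y∙xz)
open import Data.Bool using (Bool; true; false)
open import Data.Empty using (⊥-elim)
open import Data.List using (List; []; _∷_; length; map; _++_; [_]; _∷ʳ_; take; initLast; _∷ʳ′_; upTo; applyUpTo; cartesianProduct; filter; replicate; deduplicate)
open import Data.List.Membership.DecPropositional _≟_ using (_∈?_)
open import Data.List.Membership.Propositional using (_∈_)
open import Data.List.Membership.Propositional.Properties
open import Data.List.Properties using (length-++; length-map; length-replicate; length-filter; map-∘; map-id-local; map-injective; map-applyUpTo; ∷ʳ-injective; filter-accept; filter-++; filter-none; filter-some)
import Data.List.Relation.Unary.All as All
open All using (All; []; _∷_)
open import Data.List.Relation.Unary.All.Properties using (¬Any⇒All¬; replicate⁺)
open import Data.List.Relation.Unary.AllPairs using ([]; _∷_)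
open import Data.List.Relation.Unary.Any using (here; there)
open import Data.List.Relation.Unary.Unique.DecPropositional.Properties _≟_ using (deduplicate-!)
open import Data.List.Relation.Unary.Unique.Propositional using (Unique)
import Data.List.Relation.Unary.Unique.Propositional.Properties as Unique
open import Data.Nat.Combinatorics using (_C_; nCk+nC[k+1]≡[n+1]C[k+1])
open import Data.Nat.Induction using (<-rec)
open import Data.Nat.ListAction using (sum)
open import Data.Nat.Properties
open import Data.Product using (Σ; _×_; _,_; proj₁; proj₂)
open import Data.Sum using (_⊎_; inj₁; inj₂)
import Data.Sum as Sum
open import Function using (_∘_)
open import Function.Bundles using (_⇔_; mk⇔; Equivalence)
open Equivalence using (to; from)
open import Relation.Binary using (tri<; tri≈; tri>)
open import Relation.Binary.PropositionalEquality hiding ([_])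
open import Relation.Nullary using (¬_; yes; no; does)
open import Relation.Unary using (_≐_; Decidable; ∁)
open import Relation.Unary.Properties using (∁?)

-- Counting

Card′ : {A : Set} → (A → Set) → ℕ → Set
Card′ {A} P N = Σ (List A) (λ L → Unique L × (∀ x → (x ∈ L) ⇔ P x) × length L ≡ N)

module _ {A : Set} where

  card-cong : {P Q : A → Set} {N : ℕ} → P ≐ Q → Card′ P N → Card′ Q N
  card-cong (P⊆Q , Q⊆P) (L , L! , L⇔P , refl) =
    L , L! , (λ x → mk⇔ (λ x∈L → P⊆Q (to (L⇔P x) x∈L)) (λ Qx → from (L⇔P x) (Q⊆P Qx))) , refl

  card-∅ : {P : A → Set} → (∀ x → ¬ P x) → Card′ P 0
  card-∅ ¬P = [] , [] , (λ x → mk⇔ (λ ()) (λ Px → ⊥-elim (¬P x Px))) , refl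

  card-singleton : {P : A → Set} (a : A) → P a → (∀ {x} → P x → x ≡ a) → Card′ P 1
  card-singleton a Pa unique =
    [ a ] , (All.[] ∷ []) , (λ x → mk⇔ (λ { (here refl) → Pa }) (λ Px → here (unique Px))) , refl

  card-⊎ : {P Q : A → Set} {N M : ℕ} → (∀ {x} → P x → ¬ Q x) →
           Card′ P N → Card′ Q M → Card′ (λ x → P x ⊎ Q x) (N + M)
  card-⊎ disj (L , L! , L⇔P , refl) (L′ , L′! , L′⇔Q , refl) =
    L ++ L′ ,
    Unique.++⁺ L! L′! (λ (x∈L , x∈L′) → disj (to (L⇔P _) x∈L) (to (L′⇔Q _) x∈L′)) ,
    (λ x → mk⇔ (λ x∈ → Sum.map (to (L⇔P x)) (to (L′⇔Q x)) (∈-++⁻ L x∈))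
                (λ { (inj₁ Px) → ∈-++⁺ˡ (from (L⇔P x) Px) ; (inj₂ Qx) → ∈-++⁺ʳ L (from (L′⇔Q x) Qx) })) ,
    length-++ L

  Unique-map⁺-on : {B : Set} (f : A → B) {xs : List A} →
                   (∀ {x y} → x ∈ xs → y ∈ xs → f x ≡ f y → x ≡ y) → Unique xs → Unique (map f xs)
  Unique-map⁺-on f {[]} _ [] = []
  Unique-map⁺-on f {x ∷ xs} f-inj (x∉xs ∷ xs!) =
    All.tabulate (λ z∈ fx≡z → let y , y∈xs , z≡fy = ∈-map⁻ f z∈ in
                   All.lookup x∉xs y∈xs (f-inj (here refl) (there y∈xs) (trans fx≡z z≡fy)))
    ∷ Unique-map⁺-on f (λ x∈ y∈ → f-inj (there x∈) (there y∈)) xs!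

  card-image : {B : Set} {P : A → Set} {N : ℕ} (f : A → B) →
               (∀ {x y} → P x → P y → f x ≡ f y → x ≡ y) →
               Card′ P N → Card′ (λ z → Σ A (λ x → P x × z ≡ f x)) N
  card-image f f-inj (L , L! , L⇔P , refl) =
    map f L ,
    Unique-map⁺-on f (λ x∈ y∈ → f-inj (to (L⇔P _) x∈) (to (L⇔P _) y∈)) L! ,
    (λ z → mk⇔ (λ z∈ → let x , x∈L , z≡fx = ∈-map⁻ f z∈ in x , to (L⇔P x) x∈L , z≡fx)
                (λ { (x , Px , refl) → ∈-map⁺ f (from (L⇔P x) Px) })) ,
    length-map f L

  length-cartesianProduct : {B : Set} (xs : List A) (ys : List B) →
                            length (cartesianProduct xs ys) ≡ length xs * length ys
  length-cartesianProduct [] ys = refl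
  length-cartesianProduct (x ∷ xs) ys = begin
    length (map (x ,_) ys ++ cartesianProduct xs ys)        ≡⟨ length-++ (map (x ,_) ys) ⟩
    length (map (x ,_) ys) + length (cartesianProduct xs ys) ≡⟨ cong₂ _+_ (length-map (x ,_) ys) (length-cartesianProduct xs ys) ⟩
    length ys + length xs * length ys                        ∎
    where open ≡-Reasoning

  card-× : {B : Set} {P : A → Set} {Q : B → Set} {N M : ℕ} →
           Card′ P N → Card′ Q M → Card′ (λ (p : A × B) → P (proj₁ p) × Q (proj₂ p)) (N * M)
  card-× (L , L! , L⇔P , refl) (L′ , L′! , L′⇔Q , refl) =
    cartesianProduct L L′ ,
    Unique.cartesianProduct⁺ L! L′! ,
    (λ (x , y) → mk⇔ (λ p∈ → let x∈L , y∈L′ = ∈-cartesianProduct⁻ L L′ p∈ in to (L⇔P x) x∈L , to (L′⇔Q y) y∈L′)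
                     (λ (Px , Qy) → ∈-cartesianProduct⁺ (from (L⇔P x) Px) (from (L′⇔Q y) Qy))) ,
    length-cartesianProduct L L′

  card-⋃ : (P : ℕ → A → Set) (N : ℕ → ℕ) → (∀ {t t′ x} → P t x → P t′ x → t ≡ t′) →
           (ts : List ℕ) → Unique ts → (∀ {t} → t ∈ ts → Card′ (P t) (N t)) →
           Card′ (λ x → Σ ℕ (λ t → t ∈ ts × P t x)) (sum (map N ts))
  card-⋃ P N tag [] _ _ = card-∅ (λ { x (t , () , _) })
  card-⋃ P N tag (t ∷ ts) (t∉ts ∷ ts!) cards =
    card-cong ((λ { (inj₁ Ptx) → t , here refl , Ptx ; (inj₂ (t′ , t′∈ , Pt′x)) → t′ , there t′∈ , Pt′x })
              , (λ { (_ , here refl , Ptx) → inj₁ Ptx ; (t′ , there t′∈ , Pt′x) → inj₂ (t′ , t′∈ , Pt′x) }))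
      (card-⊎ (λ { Ptx (t′ , t′∈ , Pt′x) → All.lookup t∉ts t′∈ (tag Ptx Pt′x) })
              (cards (here refl)) (card-⋃ P N tag ts ts! (λ t′∈ → cards (there t′∈))))

∈-range⁻ : ∀ lo hi {t} → t ∈ map (lo +_) (upTo (suc hi ∸ lo)) → lo ≤ t × t ≤ hi
∈-range⁻ lo hi t∈ with ∈-map⁻ (lo +_) t∈
... | s , s∈ , refl = m≤m+n lo s , bound lo hi (∈-upTo⁻ s∈)
  where
  bound : ∀ lo hi {s} → s < suc hi ∸ lo → lo + s ≤ hi
  bound zero hi s<1+hi = ≤-pred s<1+hi
  bound (suc zero) zero ()
  bound (suc (suc lo)) zero ()
  bound (suc lo) (suc hi) s<hi-lo = s≤s (bound lo hi s<hi-lo)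

∈-range⁺ : ∀ lo hi {t} → lo ≤ t → t ≤ hi → t ∈ map (lo +_) (upTo (suc hi ∸ lo))
∈-range⁺ lo hi {t} lo≤t t≤hi =
  subst (_∈ map (lo +_) (upTo (suc hi ∸ lo))) (m+[n∸m]≡n lo≤t)
    (∈-map⁺ (lo +_) (∈-upTo⁺ (m+n≤o⇒m≤o∸n (suc (t ∸ lo))
      (subst (_≤ suc hi) (sym (cong suc (m∸n+n≡m lo≤t))) (s≤s t≤hi)))))

card-⋃-range : {A : Set} (P : ℕ → A → Set) (N : ℕ → ℕ) → (∀ {t t′ x} → P t x → P t′ x → t ≡ t′) →
               ∀ lo hi → (∀ {t} → lo ≤ t → t ≤ hi → Card′ (P t) (N t)) →
               Card′ (λ x → Σ ℕ (λ t → lo ≤ t × t ≤ hi × P t x)) (sumFromTo lo hi N)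
card-⋃-range P N tag lo hi cards =
  subst (Card′ _) (cong sum (sym (map-∘ (upTo (suc hi ∸ lo)))))
    (card-cong ((λ (t , t∈ , Ptx) → let lo≤t , t≤hi = ∈-range⁻ lo hi t∈ in t , lo≤t , t≤hi , Ptx)
               , (λ (t , lo≤t , t≤hi , Ptx) → t , ∈-range⁺ lo hi lo≤t t≤hi , Ptx))
      (card-⋃ P N tag (map (lo +_) (upTo (suc hi ∸ lo)))
        (Unique.map⁺ (+-cancelˡ-≡ lo _ _) (Unique.upTo⁺ (suc hi ∸ lo)))
        (λ t∈ → let lo≤t , t≤hi = ∈-range⁻ lo hi t∈ in cards lo≤t t≤hi)))

-- Boolean masks

trues : List Bool → ℕ
trues [] = 0
trues (true ∷ b) = suc (trues b)
trues (false ∷ b) = trues b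

falses : List Bool → ℕ
falses [] = 0
falses (true ∷ b) = falses b
falses (false ∷ b) = suc (falses b)

falses+trues≡length : ∀ b → falses b + trues b ≡ length b
falses+trues≡length [] = refl
falses+trues≡length (true ∷ b) = trans (+-suc (falses b) (trues b)) (cong suc (falses+trues≡length b))
falses+trues≡length (false ∷ b) = cong suc (falses+trues≡length b)

falses≡length∸trues : ∀ b → falses b ≡ length b ∸ trues b
falses≡length∸trues b = sym (trans (cong (_∸ trues b) (sym (falses+trues≡length b))) (m+n∸n≡m (falses b) (trues b)))

trues≤length : ∀ b → trues b ≤ length b
trues≤length b = subst (trues b ≤_) (falses+trues≡length b) (m≤n+m (trues b) (falses b))

Mask : ℕ → ℕ → List Bool → Set
Mask n i b = length b ≡ n × trues b ≡ i

card-Mask : ∀ n i → Card′ (Mask n i) (n C i)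
card-Mask zero zero = card-singleton [] (refl , refl) (λ { {[]} _ → refl ; {_ ∷ _} (() , _) })
card-Mask zero (suc i) = card-∅ (λ { [] (_ , ()) ; (_ ∷ _) (() , _) })
card-Mask (suc n) zero =
  card-cong ((λ { (b , (len , #t) , refl) → cong suc len , #t })
            , (λ { {false ∷ b} (len , #t) → b , (suc-injective len , #t) , refl
                 ; {true ∷ b} (_ , ()) ; {[]} (() , _) }))
    (card-image (false ∷_) (λ _ _ → λ { refl → refl }) (card-Mask n zero))
card-Mask (suc n) (suc i) =
  subst (Card′ (Mask (suc n) (suc i))) (nCk+nC[k+1]≡[n+1]C[k+1] n i)
    (card-cong ((λ { (inj₁ (b , (len , #t) , refl)) → cong suc len , cong suc #t
                   ; (inj₂ (b , (len , #t) , refl)) → cong suc len , #t })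
               , (λ { {true ∷ b} (len , #t) → inj₁ (b , (suc-injective len , suc-injective #t) , refl)
                    ; {false ∷ b} (len , #t) → inj₂ (b , (suc-injective len , #t) , refl)
                    ; {[]} (() , _) }))
      (card-⊎ (λ { (_ , _ , refl) (_ , _ , ()) })
        (card-image (true ∷_) (λ _ _ → λ { refl → refl }) (card-Mask n i))
        (card-image (false ∷_) (λ _ _ → λ { refl → refl }) (card-Mask n (suc i)))))

-- Riffling two lists along a mask

module _ {A : Set} where

  riffle : List Bool → List A → List A → List A
  riffle [] xs ys = []
  riffle (false ∷ b) [] ys = []
  riffle (false ∷ b) (x ∷ xs) ys = x ∷ riffle b xs ys
  riffle (true ∷ b) xs [] = []
  riffle (true ∷ b) xs (y ∷ ys) = y ∷ riffle b xs ys

  Fits : List Bool → List A → List A → Set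
  Fits b xs ys = falses b ≡ length xs × trues b ≡ length ys

  length-riffle : ∀ b {xs ys} → Fits b xs ys → length (riffle b xs ys) ≡ length b
  length-riffle [] _ = refl
  length-riffle (false ∷ b) {x ∷ xs} (#f , #t) = cong suc (length-riffle b (suc-injective #f , #t))
  length-riffle (true ∷ b) {ys = y ∷ ys} (#f , #t) = cong suc (length-riffle b (#f , suc-injective #t))

  ∈-riffle⁻ : ∀ b {xs ys v} → v ∈ riffle b xs ys → v ∈ xs ⊎ v ∈ ys
  ∈-riffle⁻ (false ∷ b) {x ∷ xs} (here refl) = inj₁ (here refl)
  ∈-riffle⁻ (false ∷ b) {x ∷ xs} (there v∈) = Sum.map₁ there (∈-riffle⁻ b v∈)
  ∈-riffle⁻ (true ∷ b) {ys = y ∷ ys} (here refl) = inj₂ (here refl)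
  ∈-riffle⁻ (true ∷ b) {ys = y ∷ ys} (there v∈) = Sum.map₂ there (∈-riffle⁻ b v∈)

  ∈-riffle⁺ˡ : ∀ b {xs ys v} → Fits b xs ys → v ∈ xs → v ∈ riffle b xs ys
  ∈-riffle⁺ˡ [] {x ∷ xs} (() , _) _
  ∈-riffle⁺ˡ (false ∷ b) {x ∷ xs} _ (here refl) = here refl
  ∈-riffle⁺ˡ (false ∷ b) {x ∷ xs} (#f , #t) (there v∈) = there (∈-riffle⁺ˡ b (suc-injective #f , #t) v∈)
  ∈-riffle⁺ˡ (true ∷ b) {ys = y ∷ ys} (#f , #t) v∈ = there (∈-riffle⁺ˡ b (#f , suc-injective #t) v∈)

  ∈-riffle⁺ʳ : ∀ b {xs ys v} → Fits b xs ys → v ∈ ys → v ∈ riffle b xs ys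
  ∈-riffle⁺ʳ [] {ys = y ∷ ys} (_ , ()) _
  ∈-riffle⁺ʳ (true ∷ b) {ys = y ∷ ys} _ (here refl) = here refl
  ∈-riffle⁺ʳ (true ∷ b) {ys = y ∷ ys} (#f , #t) (there v∈) = there (∈-riffle⁺ʳ b (#f , suc-injective #t) v∈)
  ∈-riffle⁺ʳ (false ∷ b) {x ∷ xs} (#f , #t) v∈ = there (∈-riffle⁺ʳ b (suc-injective #f , #t) v∈)

  module _ {Q : A → Set} (Q? : Decidable Q) where

    maskOf : List A → List Bool
    maskOf = map (λ v → does (Q? v))

    riffle-filter : ∀ r → Fits (maskOf r) (filter (∁? Q?) r) (filter Q? r) ×
                          riffle (maskOf r) (filter (∁? Q?) r) (filter Q? r) ≡ r
    riffle-filter [] = (refl , refl) , refl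
    riffle-filter (x ∷ r) with Q? x | riffle-filter r
    ... | yes _ | (#f , #t) , eq = (#f , cong suc #t) , cong (x ∷_) eq
    ... | no _  | (#f , #t) , eq = (cong suc #f , #t) , cong (x ∷_) eq

    riffle-recover : ∀ b {xs ys} → Fits b xs ys → All (∁ Q) xs → All Q ys →
                     maskOf (riffle b xs ys) ≡ b × filter (∁? Q?) (riffle b xs ys) ≡ xs × filter Q? (riffle b xs ys) ≡ ys
    riffle-recover [] {[]} {[]} _ _ _ = refl , refl , refl
    riffle-recover (false ∷ b) {x ∷ xs} (#f , #t) (¬Qx ∷ ¬Qxs) Qys with Q? x | riffle-recover b (suc-injective #f , #t) ¬Qxs Qys
    ... | yes Qx | _ = ⊥-elim (¬Qx Qx)
    ... | no _ | b≡ , xs≡ , ys≡ = cong (false ∷_) b≡ , cong (x ∷_) xs≡ , ys≡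
    riffle-recover (true ∷ b) {ys = y ∷ ys} (#f , #t) ¬Qxs (Qy ∷ Qys) with Q? y | riffle-recover b (#f , suc-injective #t) ¬Qxs Qys
    ... | no ¬Qy | _ = ⊥-elim (¬Qy Qy)
    ... | yes _ | b≡ , xs≡ , ys≡ = cong (true ∷_) b≡ , xs≡ , cong (y ∷_) ys≡

  riffle-injective : {Q : A → Set} (Q? : Decidable Q) {b b′ : List Bool} {xs ys xs′ ys′ : List A} →
                     Fits b xs ys → All (∁ Q) xs → All Q ys →
                     Fits b′ xs′ ys′ → All (∁ Q) xs′ → All Q ys′ →
                     riffle b xs ys ≡ riffle b′ xs′ ys′ → b ≡ b′ × xs ≡ xs′ × ys ≡ ys′
  riffle-injective Q? {b} {b′} fits ¬Qxs Qys fits′ ¬Qxs′ Qys′ eq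
    with riffle-recover Q? b fits ¬Qxs Qys | riffle-recover Q? b′ fits′ ¬Qxs′ Qys′
  ... | b≡ , xs≡ , ys≡ | b′≡ , xs′≡ , ys′≡ =
    trans (sym b≡) (trans (cong (maskOf Q?) eq) b′≡) ,
    trans (sym xs≡) (trans (cong (filter (∁? Q?)) eq) xs′≡) ,
    trans (sym ys≡) (trans (cong (filter Q?) eq) ys′≡)

Fits-Mask : ∀ {A : Set} {n i} b (xs ys : List A) → Mask n i b → length xs ≡ n ∸ i → length ys ≡ i → Fits b xs ys
Fits-Mask b xs ys (len , #t) len-xs len-ys =
  trans (falses≡length∸trues b) (trans (cong₂ _∸_ len #t) (sym len-xs)) , trans #t (sym len-ys)

-- Block sizes

blockSize-++ : ∀ c xs ys → blockSize c (xs ++ ys) ≡ blockSize c xs + blockSize c ys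
blockSize-++ c xs ys = trans (cong length (filter-++ (c ≟_) xs ys)) (length-++ (filter (c ≟_) xs))

blockSize-∷ : ∀ c x r → blockSize c (x ∷ r) ≡ blockSize c [ x ] + blockSize c r
blockSize-∷ c x r = blockSize-++ c [ x ] r

blockSize-∉ : ∀ {c} r → ¬ c ∈ r → blockSize c r ≡ 0
blockSize-∉ {c} r c∉r = cong length (filter-none (c ≟_) (¬Any⇒All¬ r c∉r))

blockSize-pos : ∀ {c r} → c ∈ r → 0 < blockSize c r
blockSize-pos {c} c∈r = filter-some (c ≟_) c∈r

blockSize≤length : ∀ c r → blockSize c r ≤ length r
blockSize≤length c r = length-filter (c ≟_) r

blockSize-[≡] : ∀ c → blockSize c [ c ] ≡ 1
blockSize-[≡] c = cong length (filter-accept (c ≟_) refl)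

blockSize-[≢] : ∀ {c x} → c ≢ x → blockSize c [ x ] ≡ 0
blockSize-[≢] {x = x} c≢x = blockSize-∉ [ x ] λ { (here c≡x) → c≢x c≡x }

blockSize-replicate : ∀ v i → blockSize v (replicate i v) ≡ i
blockSize-replicate v zero = refl
blockSize-replicate v (suc i) = trans (blockSize-∷ v v (replicate i v)) (cong₂ _+_ (blockSize-[≡] v) (blockSize-replicate v i))

blockSize-filter : {Q : ℕ → Set} (Q? : Decidable Q) → ∀ c r → blockSize c (filter Q? r) ≤ blockSize c r
blockSize-filter Q? c [] = z≤n
blockSize-filter Q? c (x ∷ r) with Q? x
... | yes _ = subst₂ _≤_ (sym (blockSize-∷ c x (filter Q? r))) (sym (blockSize-∷ c x r))
                (+-monoʳ-≤ (blockSize c [ x ]) (blockSize-filter Q? c r))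
... | no _ = subst (blockSize c (filter Q? r) ≤_) (sym (blockSize-∷ c x r))
               (m≤n⇒m≤o+n (blockSize c [ x ]) (blockSize-filter Q? c r))

blockSize-[-]-map : ∀ (g : ℕ → ℕ) c v x → (g x ≡ c → x ≡ v) → blockSize c [ g x ] ≤ blockSize v [ x ]
blockSize-[-]-map g c v x fiber with c ≟ g x
... | no c≢gx = subst (_≤ blockSize v [ x ]) (sym (blockSize-[≢] c≢gx)) z≤n
... | yes c≡gx with refl ← fiber (sym c≡gx) = subst (blockSize c [ g x ] ≤_) (sym (blockSize-[≡] x)) (blockSize≤length c [ g x ])

blockSize-map-≤ : ∀ (g : ℕ → ℕ) c v r → (∀ {y} → y ∈ r → g y ≡ c → y ≡ v) →
                  blockSize c (map g r) ≤ blockSize v r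
blockSize-map-≤ g c v [] _ = z≤n
blockSize-map-≤ g c v (x ∷ r) fiber =
  subst₂ _≤_ (sym (blockSize-∷ c (g x) (map g r))) (sym (blockSize-∷ v x r))
    (+-mono-≤ (blockSize-[-]-map g c v x (fiber (here refl)))
              (blockSize-map-≤ g c v r (λ y∈r → fiber (there y∈r))))

blockSize-map-≥ : ∀ (g : ℕ → ℕ) c r → blockSize c r ≤ blockSize (g c) (map g r)
blockSize-map-≥ g c [] = z≤n
blockSize-map-≥ g c (x ∷ r) =
  subst₂ _≤_ (sym (blockSize-∷ c x r)) (sym (blockSize-∷ (g c) (g x) (map g r)))
    (+-mono-≤ (singleton x) (blockSize-map-≥ g c r))
  where
  singleton : ∀ x → blockSize c [ x ] ≤ blockSize (g c) [ g x ]
  singleton x with c ≟ x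
  ... | no c≢x = subst (_≤ blockSize (g c) [ g x ]) (sym (blockSize-[≢] c≢x)) z≤n
  ... | yes refl = ≤-reflexive (trans (blockSize-[≡] c) (sym (blockSize-[≡] (g c))))

blockSize-map-injective : ∀ (g : ℕ → ℕ) → (∀ {x y} → g x ≡ g y → x ≡ y) →
                          ∀ c r → blockSize (g c) (map g r) ≡ blockSize c r
blockSize-map-injective g g-inj c r = ≤-antisym (blockSize-map-≤ g (g c) c r (λ _ → g-inj)) (blockSize-map-≥ g c r)

blockSize-riffle : ∀ c b {xs ys} → Fits b xs ys → blockSize c (riffle b xs ys) ≡ blockSize c xs + blockSize c ys
blockSize-riffle c [] {[]} {[]} _ = refl
blockSize-riffle c (false ∷ b) {x ∷ xs} {ys} (#f , #t) = begin
  blockSize c (x ∷ riffle b xs ys)                            ≡⟨ blockSize-∷ c x _ ⟩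
  blockSize c [ x ] + blockSize c (riffle b xs ys)            ≡⟨ cong (blockSize c [ x ] +_) (blockSize-riffle c b (suc-injective #f , #t)) ⟩
  blockSize c [ x ] + (blockSize c xs + blockSize c ys)       ≡⟨ +-assoc (blockSize c [ x ]) _ _ ⟨
  blockSize c [ x ] + blockSize c xs + blockSize c ys         ≡⟨ cong (_+ blockSize c ys) (blockSize-∷ c x xs) ⟨
  blockSize c (x ∷ xs) + blockSize c ys                       ∎
  where open ≡-Reasoning
blockSize-riffle c (true ∷ b) {xs} {y ∷ ys} (#f , #t) = begin
  blockSize c (y ∷ riffle b xs ys)                            ≡⟨ blockSize-∷ c y _ ⟩
  blockSize c [ y ] + blockSize c (riffle b xs ys)            ≡⟨ cong (blockSize c [ y ] +_) (blockSize-riffle c b (#f , suc-injective #t)) ⟩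
  blockSize c [ y ] + (blockSize c xs + blockSize c ys)       ≡⟨ x∙yz≈y∙xz +-commutativeSemigroup (blockSize c [ y ]) (blockSize c xs) (blockSize c ys) ⟩
  blockSize c xs + (blockSize c [ y ] + blockSize c ys)       ≡⟨ cong (blockSize c xs +_) (blockSize-∷ c y ys) ⟨
  blockSize c xs + blockSize c (y ∷ ys)                       ∎
  where open ≡-Reasoning

blockSize-+-map : ∀ a c r → blockSize (a + c) (map (a +_) r) ≡ blockSize c r
blockSize-+-map a = blockSize-map-injective (a +_) (+-cancelˡ-≡ a _ _)

blockSize-<-+-map : ∀ {a c} r → c < a → blockSize c (map (a +_) r) ≡ 0
blockSize-<-+-map {a} r c<a = blockSize-∉ (map (a +_) r) λ c∈ → let v , _ , c≡a+v = ∈-map⁻ (a +_) c∈ in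
  <⇒≱ c<a (subst (a ≤_) (sym c≡a+v) (m≤m+n a v))

+-map-∸-map : ∀ a {r} → All (a ≤_) r → map (a +_) (map (_∸ a) r) ≡ r
+-map-∸-map a {r} a≤r = trans (sym (map-∘ r)) (map-id-local (All.map m+[n∸m]≡n a≤r))

∈-replicate⁻ : ∀ {A : Set} {v c : A} i → v ∈ replicate i c → v ≡ c
∈-replicate⁻ (suc i) (here refl) = refl
∈-replicate⁻ (suc i) (there v∈) = ∈-replicate⁻ i v∈

filter-≟ : ∀ c r → filter (c ≟_) r ≡ replicate (blockSize c r) c
filter-≟ c r = all-equal (All.tabulate (λ v∈ → sym (proj₂ (∈-filter⁻ (c ≟_) {xs = r} v∈))))
  where
  all-equal : ∀ {xs : List ℕ} → All (_≡ c) xs → xs ≡ replicate (length xs) c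
  all-equal [] = refl
  all-equal (refl ∷ xs≡c) = cong (c ∷_) (all-equal xs≡c)

riffle-block : ∀ c r → Fits (maskOf (c ≟_) r) (filter (∁? (c ≟_)) r) (replicate (blockSize c r) c) ×
                       riffle (maskOf (c ≟_) r) (filter (∁? (c ≟_)) r) (replicate (blockSize c r) c) ≡ r
riffle-block c r =
  subst (λ ys → Fits (maskOf (c ≟_) r) (filter (∁? (c ≟_)) r) ys × riffle (maskOf (c ≟_) r) (filter (∁? (c ≟_)) r) ys ≡ r)
        (filter-≟ c r) (riffle-filter (c ≟_) r)

-- Sparse chains and normalization

Sparse : ℕ → List ℕ → Set
Sparse K r = ∀ c → blockSize c r < K

¬Contains⇒Sparse : ∀ {K} r → ¬ Contains K r → Sparse K r
¬Contains⇒Sparse r ¬contains c = ≰⇒> (λ K≤ → ¬contains (c , K≤))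

Sparse⇒¬Contains : ∀ {K} r → Sparse K r → ¬ Contains K r
Sparse⇒¬Contains r sparse (c , K≤) = <⇒≱ (sparse c) K≤

Sparse-map⁺ : ∀ {K} (g : ℕ → ℕ) {r} → (∀ {x y} → x ∈ r → y ∈ r → g x ≡ g y → x ≡ y) →
              Sparse K r → Sparse K (map g r)
Sparse-map⁺ g {r} g-inj sparse c with c ∈? map g r
... | no c∉ = subst (_< _) (sym (blockSize-∉ (map g r) c∉)) (≤-<-trans z≤n (sparse 0))
... | yes c∈ = let y , y∈r , c≡gy = ∈-map⁻ g c∈ in
  ≤-<-trans (blockSize-map-≤ g c y r (λ x∈r gx≡c → g-inj x∈r y∈r (trans gx≡c c≡gy))) (sparse y)

Sparse-map⁻ : ∀ {K} (g : ℕ → ℕ) {r} → Sparse K (map g r) → Sparse K r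
Sparse-map⁻ g {r} sparse c = ≤-<-trans (blockSize-map-≥ g c r) (sparse (g c))

Sparse-filter : ∀ {K} {Q : ℕ → Set} (Q? : Decidable Q) r → Sparse K r → Sparse K (filter Q? r)
Sparse-filter Q? r sparse c = ≤-<-trans (blockSize-filter Q? c r) (sparse c)

Sparse-∸-map : ∀ {K} a {U} → All (a ≤_) U → Sparse K U → Sparse K (map (_∸ a) U)
Sparse-∸-map a {U} a≤U sparse c =
  subst (_< _) (sym (trans (sym (blockSize-+-map a c (map (_∸ a) U))) (cong (blockSize (a + c)) (+-map-∸-map a a≤U)))) (sparse (a + c))

length-mono-⊆ : {A : Set} {xs ys : List A} → Unique xs → (∀ {x} → x ∈ xs → x ∈ ys) → length xs ≤ length ys
length-mono-⊆ {xs = []} _ _ = z≤n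
length-mono-⊆ {xs = x ∷ xs} {ys} (x∉xs ∷ xs!) xs⊆ys with ∈-∃++ (xs⊆ys (here refl))
... | p , q , refl = begin
  suc (length xs)           ≤⟨ s≤s (length-mono-⊆ xs! xs⊆p++q) ⟩
  suc (length (p ++ q))     ≡⟨ cong suc (length-++ p) ⟩
  suc (length p + length q) ≡⟨ +-suc (length p) (length q) ⟨
  length p + length (x ∷ q) ≡⟨ length-++ p ⟨
  length (p ++ x ∷ q)       ∎
  where
  open ≤-Reasoning
  xs⊆p++q : ∀ {y} → y ∈ xs → y ∈ p ++ q
  xs⊆p++q {y} y∈xs with ∈-++⁻ p (xs⊆ys (there y∈xs))
  ... | inj₁ y∈p = ∈-++⁺ˡ y∈p
  ... | inj₂ (here refl) = ⊥-elim (All.lookup x∉xs y∈xs refl)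
  ... | inj₂ (there y∈q) = ∈-++⁺ʳ p y∈q

rank : List ℕ → ℕ → ℕ
rank xs v = length (deduplicate _≟_ (filter (_<? v) xs))

rank-< : ∀ xs {v w} → v ∈ xs → v < w → rank xs v < rank xs w
rank-< xs {v} {w} v∈xs v<w =
  length-mono-⊆ (All.tabulate (λ u∈ u≡v → <-irrefl (sym u≡v) (proj₂ (below u∈))) ∷ deduplicate-! _)
    λ { (here refl) → ∈-deduplicate⁺ _≟_ (∈-filter⁺ (_<? w) v∈xs v<w)
      ; (there u∈) → let u∈xs , u<v = below u∈ in ∈-deduplicate⁺ _≟_ (∈-filter⁺ (_<? w) u∈xs (<-trans u<v v<w)) }
  where
  below : ∀ {u} → u ∈ deduplicate _≟_ (filter (_<? v) xs) → u ∈ xs × u < v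
  below u∈ = ∈-filter⁻ (_<? v) (∈-deduplicate⁻ _≟_ (filter (_<? v) xs) u∈)

rank-injective : ∀ xs {v w} → v ∈ xs → w ∈ xs → rank xs v ≡ rank xs w → v ≡ w
rank-injective xs {v} {w} v∈xs w∈xs eq with <-cmp v w
... | tri< v<w _ _ = ⊥-elim (<-irrefl eq (rank-< xs v∈xs v<w))
... | tri≈ _ v≡w _ = v≡w
... | tri> _ _ w<v = ⊥-elim (<-irrefl (sym eq) (rank-< xs w∈xs w<v))

Sparse-normalize : ∀ {K} xs → Sparse K (normalize xs) ⇔ Sparse K xs
Sparse-normalize {K} xs = mk⇔ (Sparse-map⁻ {K} (rank xs) {xs}) (Sparse-map⁺ {K} (rank xs) {xs} (rank-injective xs))

-- Downward-closed lists

Downward : List ℕ → Set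
Downward r = ∀ {c} → c ∈ r → ∀ {d} → d < c → d ∈ r

Downward-cong : ∀ {r r′} → (∀ {v} → v ∈ r → v ∈ r′) → (∀ {v} → v ∈ r′ → v ∈ r) → Downward r → Downward r′
Downward-cong r⊆r′ r′⊆r downward c∈ d<c = r⊆r′ (downward (r′⊆r c∈) d<c)

0∈-nonempty : ∀ {r} → Downward r → 0 < length r → 0 ∈ r
0∈-nonempty {zero ∷ r} _ _ = here refl
0∈-nonempty {suc x ∷ r} downward _ = downward (here refl) (s≤s z≤n)

Downward-below : ∀ μ {r L} → Downward r →
                 (∀ {v} → v ∈ L → v ∈ r × v < μ) → (∀ {v} → v ∈ r → v < μ → v ∈ L) → Downward L
Downward-below μ downward L⊆ ⊆L c∈L d<c = let c∈r , c<μ = L⊆ c∈L in ⊆L (downward c∈r d<c) (<-trans d<c c<μ)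

Downward-∸-map : ∀ a {r U} → Downward r → (∀ {v} → v ∈ U → v ∈ r × a ≤ v) → (∀ {v} → v ∈ r → a ≤ v → v ∈ U) →
                 Downward (map (_∸ a) U)
Downward-∸-map a downward U⊆ ⊆U c∈ {d} d<c with ∈-map⁻ (_∸ a) c∈
... | u , u∈U , refl =
  let u∈r , a≤u = U⊆ u∈U
      a+d<u = subst (a + d <_) (m+[n∸m]≡n a≤u) (+-monoʳ-< a d<c)
  in subst (_∈ map (_∸ a) _) (m+n∸m≡n a d) (∈-map⁺ (_∸ a) (⊆U (downward u∈r a+d<u) (m≤m+n a d)))

height : List ℕ → ℕ
height [] = 0
height (x ∷ r) = suc x ⊔ height r

<-height : ∀ {v r} → v ∈ r → v < height r
<-height {r = x ∷ r} (here refl) = m≤m⊔n (suc x) (height r)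
<-height {r = x ∷ r} (there v∈) = ≤-trans (<-height v∈) (m≤n⊔m (suc x) (height r))

height-≤ : ∀ {m} r → (∀ {v} → v ∈ r → v < m) → height r ≤ m
height-≤ [] _ = z≤n
height-≤ (x ∷ r) r<m = ⊔-lub (r<m (here refl)) (height-≤ r (r<m ∘ there))

height-attained : ∀ {p} r → height r ≡ suc p → p ∈ r
height-attained (x ∷ r) eq with ⊔-sel (suc x) (height r)
... | inj₁ h≡1+x = here (suc-injective (trans (sym eq) h≡1+x))
... | inj₂ h≡hr = there (height-attained r (trans (sym h≡hr) eq))

∈-height : ∀ {r} → Downward r → ∀ {v} → v < height r → v ∈ r
∈-height {r} downward {v} v<h with height r in eq
... | suc p with m≤n⇒m<n∨m≡n (≤-pred v<h)
...   | inj₁ v<p = downward (height-attained r eq) v<p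
...   | inj₂ refl = height-attained r eq

height-unique : ∀ {m} r → (∀ {v} → v ∈ r → v < m) → (∀ {v} → v < m → v ∈ r) → height r ≡ m
height-unique {zero} r r<m _ = n≤0⇒n≡0 (height-≤ r r<m)
height-unique {suc p} r r<m m⊆r = ≤-antisym (height-≤ r r<m) (<-height (m⊆r ≤-refl))

-- Avoiding chains: peeling off the lowest block

join₀ : List Bool × List ℕ → List ℕ
join₀ (b , r) = riffle b (map suc r) (replicate (trues b) 0)

Split₀ : ℕ → ℕ → ℕ → List Bool × List ℕ → Set
Split₀ K n i (b , r) = Mask n i b × Avoid K (n ∸ i) r

module _ {n i : ℕ} (b : List Bool) (r : List ℕ) (mask : Mask n i b) (len : length r ≡ n ∸ i) where

  Fits-join₀ : Fits b (map suc r) (replicate (trues b) 0)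
  Fits-join₀ = Fits-Mask b (map suc r) (replicate (trues b) 0) mask
                          (trans (length-map suc r) len) (trans (length-replicate (trues b)) (proj₂ mask))

  blockSize-join₀ : ∀ c → blockSize c (join₀ (b , r)) ≡ blockSize c (map suc r) + blockSize c (replicate (trues b) 0)
  blockSize-join₀ c = blockSize-riffle c b Fits-join₀

  blockSize₀-join₀ : blockSize 0 (join₀ (b , r)) ≡ i
  blockSize₀-join₀ = trans (blockSize-join₀ 0)
    (cong₂ _+_ (blockSize-<-+-map r (s≤s z≤n)) (trans (blockSize-replicate 0 (trues b)) (proj₂ mask)))

  Avoid-join₀ : ∀ {K} → Downward r → Sparse K r → 0 < i → i < K → Avoid K n (join₀ (b , r))
  Avoid-join₀ {K} downward sparse 0<i i<K =
    (trans (length-riffle b Fits-join₀) (proj₁ mask) , downward′) , Sparse⇒¬Contains (join₀ (b , r)) sparse′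
    where
    downward′ : Downward (join₀ (b , r))
    downward′ c∈ {d} d<c with ∈-riffle⁻ b c∈
    ... | inj₂ c∈0s = ⊥-elim (n≮0 (subst (d <_) (∈-replicate⁻ (trues b) c∈0s) d<c))
    ... | inj₁ c∈sr with d | ∈-map⁻ suc c∈sr
    ...   | zero | _ = ∈-riffle⁺ʳ b Fits-join₀ (subst (λ t → 0 ∈ replicate t 0) (sym (proj₂ mask)) (0∈replicate 0<i))
      where
      0∈replicate : ∀ {t} → 0 < t → 0 ∈ replicate t 0
      0∈replicate {suc t} _ = here refl
    ...   | suc d | c′ , c′∈r , refl = ∈-riffle⁺ˡ b Fits-join₀ (∈-map⁺ suc (downward c′∈r (≤-pred d<c)))
    sparse′ : Sparse K (join₀ (b , r))
    sparse′ zero = subst (_< K) (sym blockSize₀-join₀) i<K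
    sparse′ (suc c) = subst (_< K) (sym (trans (blockSize-join₀ (suc c))
        (trans (cong₂ _+_ (blockSize-+-map 1 c r) (blockSize-∉ (replicate (trues b) 0) (λ c∈ → 1+n≢0 (∈-replicate⁻ (trues b) c∈))))
               (+-identityʳ _))))
      (sparse c)

map-suc-nonzero : ∀ r → All (∁ (0 ≡_)) (map suc r)
map-suc-nonzero r = All.tabulate λ v∈ 0≡v → let _ , _ , v≡1+u = ∈-map⁻ suc v∈ in 0≢1+n (trans 0≡v v≡1+u)

join₀-injective : ∀ {K n i p p′} → Split₀ K n i p → Split₀ K n i p′ → join₀ p ≡ join₀ p′ → p ≡ p′
join₀-injective {p = b , r} {b′ , r′} (mask , (len , _) , _) (mask′ , (len′ , _) , _) eq
  with b≡b′ , sr≡sr′ , _ ← riffle-injective (0 ≟_) (Fits-join₀ b r mask len) (map-suc-nonzero r) (replicate⁺ (trues b) refl)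
                                                    (Fits-join₀ b′ r′ mask′ len′) (map-suc-nonzero r′) (replicate⁺ (trues b′) refl) eq
  = cong₂ _,_ b≡b′ (map-injective suc-injective sr≡sr′)

split₀ : List ℕ → List Bool × List ℕ
split₀ r = maskOf (0 ≟_) r , map (_∸ 1) (filter (∁? (0 ≟_)) r)

module _ (r : List ℕ) where

  private
    fits = proj₁ (riffle-block 0 r)
    positive : All (1 ≤_) (filter (∁? (0 ≟_)) r)
    positive = All.tabulate λ v∈ → n≢0⇒n>0 (λ v≡0 → proj₂ (∈-filter⁻ (∁? (0 ≟_)) {xs = r} v∈) (sym v≡0))

  trues-split₀ : trues (proj₁ (split₀ r)) ≡ blockSize 0 r
  trues-split₀ = trans (proj₂ fits) (length-replicate (blockSize 0 r))

  join₀-split₀ : join₀ (split₀ r) ≡ r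
  join₀-split₀ = trans (cong₂ (riffle (maskOf (0 ≟_) r)) (+-map-∸-map 1 positive) (cong (λ t → replicate t 0) trues-split₀))
                       (proj₂ (riffle-block 0 r))

  Split₀-split₀ : ∀ {K n} → Avoid K n r → Split₀ K n (blockSize 0 r) (split₀ r)
  Split₀-split₀ {n = n} ((len , downward) , ¬contains) =
    (trans (length-map _ r) len , trues-split₀) ,
    (len′ , Downward-∸-map 1 downward (λ v∈ → let v∈r , v≢0 = ∈-filter⁻ (∁? (0 ≟_)) {xs = r} v∈ in v∈r , n≢0⇒n>0 (v≢0 ∘ sym))
                                      (λ v∈r 1≤v → ∈-filter⁺ (∁? (0 ≟_)) v∈r (λ 0≡v → <⇒≢ 1≤v 0≡v))) ,
    Sparse⇒¬Contains (proj₂ (split₀ r)) (Sparse-∸-map 1 positive (Sparse-filter (∁? (0 ≟_)) r (¬Contains⇒Sparse r ¬contains)))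
    where
    len′ = begin
      length (map (_∸ 1) (filter (∁? (0 ≟_)) r)) ≡⟨ length-map (_∸ 1) (filter (∁? (0 ≟_)) r) ⟩
      length (filter (∁? (0 ≟_)) r)             ≡⟨ proj₁ fits ⟨
      falses (maskOf (0 ≟_) r)                  ≡⟨ falses≡length∸trues (maskOf (0 ≟_) r) ⟩
      length (maskOf (0 ≟_) r) ∸ trues (maskOf (0 ≟_) r) ≡⟨ cong₂ _∸_ (trans (length-map _ r) len) trues-split₀ ⟩
      n ∸ blockSize 0 r                         ∎
      where open ≡-Reasoning

card-Avoid-recurrence : ∀ {K n} hi (a : ℕ → ℕ) → 0 < n →
                        (∀ {i} → 0 < i → i ≤ hi → i < K) → (∀ {i} → i ≤ n → i < K → i ≤ hi) →
                        (∀ {i} → 0 < i → i ≤ hi → Card′ (Avoid K (n ∸ i)) (a (n ∸ i))) →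
                        Card′ (Avoid K n) (sumFromTo 1 hi (λ i → (n C i) * a (n ∸ i)))
card-Avoid-recurrence {K} {n} hi a 0<n admissible maximal cards =
  card-cong (sound , complete)
    (card-⋃-range Joined (λ i → (n C i) * a (n ∸ i)) tag 1 hi
      (λ {i} 0<i i≤hi → card-image join₀ join₀-injective (card-× (card-Mask n i) (cards 0<i i≤hi))))
  where
  Joined : ℕ → List ℕ → Set
  Joined i r = Σ (List Bool × List ℕ) (λ p → Split₀ K n i p × r ≡ join₀ p)

  tag : ∀ {i i′ r} → Joined i r → Joined i′ r → i ≡ i′
  tag ((b , r) , (mask , (len , _) , _) , refl) ((b′ , r′) , (mask′ , (len′ , _) , _) , eq) =
    trans (sym (blockSize₀-join₀ b r mask len)) (trans (cong (blockSize 0) eq) (blockSize₀-join₀ b′ r′ mask′ len′))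

  sound : ∀ {r} → Σ ℕ (λ i → 1 ≤ i × i ≤ hi × Joined i r) → Avoid K n r
  sound (i , 0<i , i≤hi , (b , r) , (mask , (len , downward) , ¬contains) , refl) =
    Avoid-join₀ b r mask len downward (¬Contains⇒Sparse r ¬contains) 0<i (admissible 0<i i≤hi)

  complete : ∀ {r} → Avoid K n r → Σ ℕ (λ i → 1 ≤ i × i ≤ hi × Joined i r)
  complete {r} avoid@((len , downward) , ¬contains) =
    blockSize 0 r , 0<i , maximal (subst (blockSize 0 r ≤_) len (blockSize≤length 0 r)) (¬Contains⇒Sparse r ¬contains 0) ,
    split₀ r , Split₀-split₀ r avoid , sym (join₀-split₀ r)
    where
    0<i : 0 < blockSize 0 r
    0<i = blockSize-pos (0∈-nonempty downward (subst (0 <_) (sym len) 0<n))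

-- Fubini numbers

applyUpTo-cong : ∀ {f g : ℕ → ℕ} → (∀ t → f t ≡ g t) → ∀ k → applyUpTo f k ≡ applyUpTo g k
applyUpTo-cong f≗g zero = refl
applyUpTo-cong f≗g (suc k) = cong₂ _∷_ (f≗g 0) (applyUpTo-cong (f≗g ∘ suc) k)

fubiniStep-applyUpTo : ∀ M s (g : ℕ → ℕ) k → fubiniStep M s (applyUpTo g k) ≡ sum (applyUpTo (λ t → (M C (s + t)) * g t) k)
fubiniStep-applyUpTo M s g zero = refl
fubiniStep-applyUpTo M s g (suc k) =
  cong₂ _+_ (cong (λ z → (M C z) * g 0) (sym (+-identityʳ s)))
    (trans (fubiniStep-applyUpTo M (suc s) (g ∘ suc) k)
           (cong sum (applyUpTo-cong (λ t → cong (λ z → (M C z) * g (suc t)) (sym (+-suc s t))) k)))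

fubiniList-applyUpTo : ∀ m → fubiniList m ≡ applyUpTo (λ t → fubini (m ∸ t)) (suc m)
fubiniList-applyUpTo zero = refl
fubiniList-applyUpTo (suc m) = cong (fubini (suc m) ∷_) (fubiniList-applyUpTo m)

fubini-recurrence : ∀ m → fubini (suc m) ≡ sumFromTo 1 (suc m) (λ i → (suc m C i) * fubini (suc m ∸ i))
fubini-recurrence m = begin
  fubiniStep (suc m) 1 (fubiniList m)                                             ≡⟨ cong (fubiniStep (suc m) 1) (fubiniList-applyUpTo m) ⟩
  fubiniStep (suc m) 1 (applyUpTo (λ t → fubini (m ∸ t)) (suc m))                 ≡⟨ fubiniStep-applyUpTo (suc m) 1 (λ t → fubini (m ∸ t)) (suc m) ⟩
  sum (applyUpTo (λ t → (suc m C suc t) * fubini (m ∸ t)) (suc m))                 ≡⟨ cong sum (map-applyUpTo (λ t → t) _ (suc m)) ⟨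
  sumFromTo 1 (suc m) (λ i → (suc m C i) * fubini (suc m ∸ i))                    ∎
  where open ≡-Reasoning

card-Avoid-fubini : ∀ {K} n → n < K → Card′ (Avoid K n) (fubini n)
card-Avoid-fubini {K} = <-rec (λ n → n < K → Card′ (Avoid K n) (fubini n)) step
  where
  step : ∀ n → (∀ {m} → m < n → m < K → Card′ (Avoid K m) (fubini m)) → n < K → Card′ (Avoid K n) (fubini n)
  step zero _ 0<K = card-singleton [] ((refl , (λ ())) , Sparse⇒¬Contains [] (λ _ → 0<K))
                                   (λ { {[]} _ → refl ; {_ ∷ _} ((() , _) , _) })
  step (suc m) ih n<K =
    subst (Card′ (Avoid K (suc m))) (sym (fubini-recurrence m))
      (card-Avoid-recurrence (suc m) fubini (s≤s z≤n) (λ _ i≤n → ≤-<-trans i≤n n<K) (λ i≤n _ → i≤n)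
        (λ {i} 0<i i≤n → ih (shorter i 0<i) (≤-<-trans (m∸n≤m (suc m) i) n<K)))
    where
    shorter : ∀ i → 0 < i → suc m ∸ i < suc m
    shorter (suc i) _ = s≤s (m∸n≤m m i)

-- Splitting a chain at a missing value

gapJoin : List Bool → List ℕ → List ℕ → List ℕ
gapJoin bU rL rU = riffle bU (map (suc (height rL) +_) rU) rL

∈-gapJoin⁻ : ∀ bU rL rU {v} → v ∈ gapJoin bU rL rU →
             (v ∈ rL × v < height rL) ⊎ Σ ℕ (λ u → u ∈ rU × v ≡ suc (height rL) + u)
∈-gapJoin⁻ bU rL rU v∈ with ∈-riffle⁻ bU v∈
... | inj₂ v∈rL = inj₁ (v∈rL , <-height v∈rL)
... | inj₁ v∈rU = inj₂ (∈-map⁻ (suc (height rL) +_) v∈rU)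

height∉gapJoin : ∀ bU rL rU → ¬ height rL ∈ gapJoin bU rL rU
height∉gapJoin bU rL rU μ∈ with ∈-gapJoin⁻ bU rL rU μ∈
... | inj₁ (_ , μ<μ) = <-irrefl refl μ<μ
... | inj₂ (u , _ , μ≡) = <-irrefl μ≡ (s≤s (m≤m+n (height rL) u))

All-≢height-gapJoin : ∀ bU rL rU → All (∁ (height rL ≡_)) (gapJoin bU rL rU)
All-≢height-gapJoin bU rL rU = All.tabulate λ v∈ μ≡v → height∉gapJoin bU rL rU (subst (_∈ _) (sym μ≡v) v∈)

Fits-gapJoin : ∀ {m i} bU rL rU → Mask m i bU → length rL ≡ i → length rU ≡ m ∸ i → Fits bU (map (suc (height rL) +_) rU) rL
Fits-gapJoin bU rL rU mask lenL lenU =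
  Fits-Mask bU (map (suc (height rL) +_) rU) rL mask (trans (length-map (suc (height rL) +_) rU) lenU) lenL

module _ (bU : List Bool) (rL rU : List ℕ) (fits : Fits bU (map (suc (height rL) +_) rU) rL) where

  private
    μ = height rL

  Downward-gapJoin : Downward rL → Downward rU → Downward (μ ∷ gapJoin bU rL rU)
  Downward-gapJoin downL downU (here refl) d<μ = there (∈-riffle⁺ʳ bU fits (∈-height downL d<μ))
  Downward-gapJoin downL downU (there c∈) {d} d<c with ∈-gapJoin⁻ bU rL rU c∈ | <-cmp d μ
  ... | inj₁ (c∈rL , _) | _ = there (∈-riffle⁺ʳ bU fits (downL c∈rL d<c))
  ... | inj₂ _ | tri< d<μ _ _ = there (∈-riffle⁺ʳ bU fits (∈-height downL d<μ))
  ... | inj₂ _ | tri≈ _ refl _ = here refl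
  ... | inj₂ (u , u∈rU , refl) | tri> _ _ μ<d =
    there (∈-riffle⁺ˡ bU fits (subst (_∈ map (suc μ +_) rU) (m+[n∸m]≡n μ<d)
      (∈-map⁺ (suc μ +_) (downU u∈rU (+-cancelˡ-< (suc μ) (d ∸ suc μ) u (subst (_< suc μ + u) (sym (m+[n∸m]≡n μ<d)) d<c))))))

  Sparse-gapJoin : ∀ {K} → Sparse K rL → Sparse K rU → Sparse K (gapJoin bU rL rU)
  Sparse-gapJoin {K} sparseL sparseU c with c <? suc μ
  ... | yes c≤μ = subst (_< K) (sym (trans (blockSize-riffle c bU fits) (cong (_+ blockSize c rL) (blockSize-<-+-map rU c≤μ))))
                    (sparseL c)
  ... | no c≰μ = subst (_< K)
                   (sym (trans (blockSize-riffle c bU fits)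
                     (cong₂ _+_ (trans (cong (λ t → blockSize t (map (suc μ +_) rU)) (sym (m+[n∸m]≡n (≮⇒≥ c≰μ))))
                                       (blockSize-+-map (suc μ) (c ∸ suc μ) rU))
                                (blockSize-∉ rL (λ c∈rL → c≰μ (≤-trans (<-height c∈rL) (n≤1+n μ)))))))
                   (subst (_< K) (sym (+-identityʳ _)) (sparseU (c ∸ suc μ)))

All-≮-suc+-map : ∀ μ rU → All (∁ (_< μ)) (map (suc μ +_) rU)
All-≮-suc+-map μ rU = All.tabulate λ v∈ v<μ → let u , _ , v≡ = ∈-map⁻ (suc μ +_) v∈ in
  <-asym v<μ (subst (μ <_) (sym v≡) (s≤s (m≤m+n μ u)))

gapJoin-injective : ∀ {bU rL rU bU′ rL′ rU′} → height rL ≡ height rL′ →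
                    Fits bU (map (suc (height rL) +_) rU) rL → Fits bU′ (map (suc (height rL′) +_) rU′) rL′ →
                    gapJoin bU rL rU ≡ gapJoin bU′ rL′ rU′ → bU ≡ bU′ × rL ≡ rL′ × rU ≡ rU′
gapJoin-injective {rL = rL} {rU} {rL′ = rL′} {rU′} μ≡μ′ fits fits′ eq
  with bU≡ , lifted≡ , rL≡ ← riffle-injective (_<? height rL) fits (All-≮-suc+-map (height rL) rU) (All.tabulate <-height)
                               fits′ (subst (λ μ → All (∁ (_< μ)) _) (sym μ≡μ′) (All-≮-suc+-map (height rL′) rU′))
                                     (subst (λ μ → All (_< μ) rL′) (sym μ≡μ′) (All.tabulate <-height)) eq
  = bU≡ , rL≡ , map-injective (+-cancelˡ-≡ (suc (height rL′)) _ _) (subst (λ μ → map (suc μ +_) rU ≡ _) μ≡μ′ lifted≡)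

lowerPart : ℕ → List ℕ → List ℕ
lowerPart μ σ = filter (_<? μ) σ

upperPart : ℕ → List ℕ → List ℕ
upperPart μ σ = map (_∸ suc μ) (filter (∁? (_<? μ)) σ)

module _ (μ : ℕ) {σ : List ℕ} where

  private
    ∈σ : ∀ {v} → v ∈ μ ∷ σ → μ ≢ v → v ∈ σ
    ∈σ (here refl) μ≢v = ⊥-elim (μ≢v refl)
    ∈σ (there v∈σ) _ = v∈σ

    above : ¬ μ ∈ σ → ∀ {v} → v ∈ filter (∁? (_<? μ)) σ → v ∈ σ × suc μ ≤ v
    above μ∉σ v∈ = let v∈σ , v≮μ = ∈-filter⁻ (∁? (_<? μ)) {xs = σ} v∈ in
      v∈σ , ≤∧≢⇒< (≮⇒≥ v≮μ) (λ μ≡v → μ∉σ (subst (_∈ σ) (sym μ≡v) v∈σ))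

  height-lowerPart : Downward (μ ∷ σ) → height (lowerPart μ σ) ≡ μ
  height-lowerPart downward = height-unique (lowerPart μ σ) (λ v∈ → proj₂ (∈-filter⁻ (_<? μ) {xs = σ} v∈))
    (λ v<μ → ∈-filter⁺ (_<? μ) (∈σ (downward (here refl) v<μ) (λ μ≡v → <-irrefl (sym μ≡v) v<μ)) v<μ)

  +-map-upperPart : ¬ μ ∈ σ → map (suc μ +_) (upperPart μ σ) ≡ filter (∁? (_<? μ)) σ
  +-map-upperPart μ∉σ = +-map-∸-map (suc μ) (All.tabulate (proj₂ ∘ above μ∉σ))

  module _ (downward : Downward (μ ∷ σ)) (μ∉σ : ¬ μ ∈ σ) where

    Fits-gapSplit : Fits (maskOf (_<? μ) σ) (map (suc (height (lowerPart μ σ)) +_) (upperPart μ σ)) (lowerPart μ σ)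
    Fits-gapSplit = subst (λ t → Fits (maskOf (_<? μ) σ) (map (suc t +_) (upperPart μ σ)) (lowerPart μ σ)) (sym (height-lowerPart downward))
      (subst (λ xs → Fits (maskOf (_<? μ) σ) xs (lowerPart μ σ)) (sym (+-map-upperPart μ∉σ)) (proj₁ (riffle-filter (_<? μ) σ)))

    gapJoin-gapSplit : gapJoin (maskOf (_<? μ) σ) (lowerPart μ σ) (upperPart μ σ) ≡ σ
    gapJoin-gapSplit = begin
      riffle (maskOf (_<? μ) σ) (map (suc (height (lowerPart μ σ)) +_) (upperPart μ σ)) (lowerPart μ σ)
        ≡⟨ cong (λ t → riffle (maskOf (_<? μ) σ) (map (suc t +_) (upperPart μ σ)) (lowerPart μ σ)) (height-lowerPart downward) ⟩
      riffle (maskOf (_<? μ) σ) (map (suc μ +_) (upperPart μ σ)) (lowerPart μ σ)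
        ≡⟨ cong (λ xs → riffle (maskOf (_<? μ) σ) xs (lowerPart μ σ)) (+-map-upperPart μ∉σ) ⟩
      riffle (maskOf (_<? μ) σ) (filter (∁? (_<? μ)) σ) (filter (_<? μ) σ)
        ≡⟨ proj₂ (riffle-filter (_<? μ) σ) ⟩
      σ ∎
      where open ≡-Reasoning

    Downward-upperPart : Downward (upperPart μ σ)
    Downward-upperPart = Downward-∸-map (suc μ) downward
      (λ v∈ → let v∈σ , μ<v = above μ∉σ v∈ in there v∈σ , μ<v)
      (λ v∈ μ<v → ∈-filter⁺ (∁? (_<? μ)) (∈σ v∈ (λ μ≡v → <-irrefl μ≡v μ<v)) (λ v<μ → <-asym v<μ μ<v))

    Sparse-upperPart : ∀ {K} → Sparse K σ → Sparse K (upperPart μ σ)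
    Sparse-upperPart sparse = Sparse-∸-map (suc μ) (All.tabulate (proj₂ ∘ above μ∉σ)) (Sparse-filter (∁? (_<? μ)) σ sparse)

  Downward-lowerPart : Downward (μ ∷ σ) → Downward (lowerPart μ σ)
  Downward-lowerPart downward = Downward-below μ downward
    (λ v∈ → let v∈σ , v<μ = ∈-filter⁻ (_<? μ) {xs = σ} v∈ in there v∈σ , v<μ)
    (λ v∈ v<μ → ∈-filter⁺ (_<? μ) (∈σ v∈ (λ μ≡v → <-irrefl (sym μ≡v) v<μ)) v<μ)

-- Stopped chains

Stopped : ℕ → ℕ → List ℕ → Set
Stopped K j r = WOC j r × Contains K r × ¬ Contains K (restrict r)

length-∷ʳ : ∀ (X : List ℕ) m → length (X ∷ʳ m) ≡ suc (length X)
length-∷ʳ X m = trans (length-++ X) (+-comm (length X) 1)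

restrict-∷ʳ : ∀ X m → restrict (X ∷ʳ m) ≡ normalize X
restrict-∷ʳ X m = cong normalize (trans (cong (λ n → take (n ∸ 1) (X ∷ʳ m)) (length-∷ʳ X m)) (take-∷ʳ X))
  where
  take-∷ʳ : ∀ X → take (length X) (X ∷ʳ m) ≡ X
  take-∷ʳ [] = refl
  take-∷ʳ (x ∷ X) = cong (x ∷_) (take-∷ʳ X)

blockSize-∷ʳ-≡ : ∀ X μ → blockSize μ (X ∷ʳ μ) ≡ suc (blockSize μ X)
blockSize-∷ʳ-≡ X μ = trans (blockSize-++ μ X [ μ ]) (trans (cong (blockSize μ X +_) (blockSize-[≡] μ)) (+-comm _ 1))

blockSize-∷ʳ-≢ : ∀ {c} X μ → c ≢ μ → blockSize c (X ∷ʳ μ) ≡ blockSize c X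
blockSize-∷ʳ-≢ {c} X μ c≢μ = trans (blockSize-++ c X [ μ ]) (trans (cong (blockSize c X +_) (blockSize-[≢] c≢μ)) (+-identityʳ _))

StopData : Set
StopData = List Bool × ((List Bool × List ℕ) × List ℕ)

-- bB places the other K₁ members of the block of the last variable; the rest interleaves,
-- along bU, the lower chain rL with the upper chain rU lifted above that block.
joinStop : ℕ → StopData → List ℕ
joinStop K₁ (bB , ((bU , rL) , rU)) = riffle bB (gapJoin bU rL rU) (replicate K₁ (height rL)) ∷ʳ height rL

SplitGap : ℕ → ℕ → ℕ → (List Bool × List ℕ) × List ℕ → Set
SplitGap K₁ m i ((bU , rL) , rU) = (Mask m i bU × Avoid (suc K₁) i rL) × Avoid (suc K₁) (m ∸ i) rU

SplitStop : ℕ → ℕ → StopData → Set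
SplitStop K₁ j′ (bB , q) = Mask j′ K₁ bB × Σ ℕ (λ i → 0 ≤ i × i ≤ j′ ∸ K₁ × SplitGap K₁ (j′ ∸ K₁) i q)

module _ {K₁ j′ : ℕ} where

  Fits-SplitStop : ∀ ((bB , ((bU , rL) , rU)) : StopData) → SplitStop K₁ j′ (bB , ((bU , rL) , rU)) →
                   Fits bU (map (suc (height rL) +_) rU) rL × Fits bB (gapJoin bU rL rU) (replicate K₁ (height rL))
  Fits-SplitStop (bB , ((bU , rL) , rU)) (maskB , _ , _ , _ , (maskU , (lenL , _) , _) , (lenU , _) , _) =
    fitsU , Fits-Mask bB (gapJoin bU rL rU) (replicate K₁ (height rL)) maskB
                      (trans (length-riffle bU fitsU) (proj₁ maskU)) (length-replicate K₁)
    where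
    fitsU : Fits bU (map (suc (height rL) +_) rU) rL
    fitsU = Fits-gapJoin bU rL rU maskU lenL lenU

  Stopped-joinStop : ∀ p → SplitStop K₁ j′ p → Stopped (suc K₁) (suc j′) (joinStop K₁ p)
  Stopped-joinStop p@(bB , ((bU , rL) , rU)) split@(maskB , _ , _ , _ , (_ , (_ , downL) , ¬containsL) , (_ , downU) , ¬containsU) =
    (trans (length-∷ʳ X μ) (cong suc (trans (length-riffle bB fitsB) (proj₁ maskB))) ,
     Downward-cong μ∷s⊆ ⊆μ∷s (Downward-gapJoin bU rL rU fitsU downL downU)) ,
    (μ , ≤-reflexive (sym (trans (blockSize-∷ʳ-≡ X μ) (cong suc blockSize-μ-X)))) ,
    subst (¬_ ∘ Contains (suc K₁)) (sym (restrict-∷ʳ X μ)) (Sparse⇒¬Contains (normalize X) (from (Sparse-normalize X) sparseX))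
    where
    μ = height rL
    s = gapJoin bU rL rU
    X = riffle bB s (replicate K₁ μ)
    fitsU = proj₁ (Fits-SplitStop p split)
    fitsB = proj₂ (Fits-SplitStop p split)

    blockSize-μ-X : blockSize μ X ≡ K₁
    blockSize-μ-X = trans (blockSize-riffle μ bB fitsB) (cong₂ _+_ (blockSize-∉ s (height∉gapJoin bU rL rU)) (blockSize-replicate μ K₁))

    sparseX : Sparse (suc K₁) X
    sparseX c with μ ≟ c
    ... | yes refl = subst (_< suc K₁) (sym blockSize-μ-X) ≤-refl
    ... | no μ≢c = subst (_< suc K₁) (sym (trans (blockSize-riffle c bB fitsB) (trans (cong (blockSize c s +_)
                     (blockSize-∉ (replicate K₁ μ) (λ c∈ → μ≢c (sym (∈-replicate⁻ K₁ c∈))))) (+-identityʳ _))))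
                     (Sparse-gapJoin bU rL rU fitsU (¬Contains⇒Sparse rL ¬containsL) (¬Contains⇒Sparse rU ¬containsU) c)

    ⊆μ∷s : ∀ {v} → v ∈ X ∷ʳ μ → v ∈ μ ∷ s
    ⊆μ∷s v∈ with ∈-++⁻ X v∈
    ... | inj₂ (here refl) = here refl
    ... | inj₁ v∈X with ∈-riffle⁻ bB v∈X
    ...   | inj₁ v∈s = there v∈s
    ...   | inj₂ v∈μs = here (∈-replicate⁻ K₁ v∈μs)

    μ∷s⊆ : ∀ {v} → v ∈ μ ∷ s → v ∈ X ∷ʳ μ
    μ∷s⊆ (here refl) = ∈-++⁺ʳ X (here refl)
    μ∷s⊆ (there v∈s) = ∈-++⁺ˡ (∈-riffle⁺ˡ bB fitsB v∈s)

  joinStop-injective : ∀ {p p′} → SplitStop K₁ j′ p → SplitStop K₁ j′ p′ → joinStop K₁ p ≡ joinStop K₁ p′ → p ≡ p′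
  joinStop-injective {p@(bB , ((bU , rL) , rU))} {p′@(bB′ , ((bU′ , rL′) , rU′))} split split′ eq
    with fitsU , fitsB ← Fits-SplitStop p split
    with fitsU′ , fitsB′ ← Fits-SplitStop p′ split′
    with X≡ , μ≡μ′ ← ∷ʳ-injective (riffle bB (gapJoin bU rL rU) (replicate K₁ (height rL))) _ eq
    with bB≡ , s≡ , _ ← riffle-injective (height rL ≟_) fitsB (All-≢height-gapJoin bU rL rU) (replicate⁺ K₁ refl)
                          fitsB′ (subst (λ μ → All (∁ (μ ≡_)) _) (sym μ≡μ′) (All-≢height-gapJoin bU′ rL′ rU′))
                                 (subst (λ μ → All (μ ≡_) (replicate K₁ (height rL′))) (sym μ≡μ′) (replicate⁺ K₁ refl)) X≡
    with refl , refl , refl ← gapJoin-injective μ≡μ′ fitsU fitsU′ s≡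
    = cong (_, ((bU , rL) , rU)) bB≡

splitStop : List ℕ → ℕ → StopData
splitStop X μ = maskOf (μ ≟_) X , ((maskOf (_<? μ) σ , lowerPart μ σ) , upperPart μ σ)
  where σ = filter (∁? (μ ≟_)) X

module _ {K₁ j′ : ℕ} (X : List ℕ) (μ : ℕ) (stopped : Stopped (suc K₁) (suc j′) (X ∷ʳ μ)) where

  private
    bB = maskOf (μ ≟_) X
    σ = filter (∁? (μ ≟_)) X
    bU = maskOf (_<? μ) σ
    rL = lowerPart μ σ
    rU = upperPart μ σ
    fitsB = proj₁ (riffle-block μ X)

    sparseX : Sparse (suc K₁) X
    sparseX = to (Sparse-normalize X)
      (¬Contains⇒Sparse (normalize X) (subst (¬_ ∘ Contains (suc K₁)) (restrict-∷ʳ X μ) (proj₂ (proj₂ stopped))))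

    blockSize-μ-X : blockSize μ X ≡ K₁
    blockSize-μ-X with proj₁ (proj₂ stopped)
    ... | c , K≤ with μ ≟ c
    ...   | yes refl = ≤-antisym (≤-pred (sparseX μ))
                         (≤-pred (subst (suc K₁ ≤_) (blockSize-∷ʳ-≡ X μ) K≤))
    ...   | no μ≢c = ⊥-elim (<⇒≱ (sparseX c) (subst (suc K₁ ≤_) (blockSize-∷ʳ-≢ X μ (μ≢c ∘ sym)) K≤))

    μ∉σ : ¬ μ ∈ σ
    μ∉σ μ∈ = proj₂ (∈-filter⁻ (∁? (μ ≟_)) {xs = X} μ∈) refl

    downwardσ : Downward (μ ∷ σ)
    downwardσ = Downward-cong ⊆μ∷σ μ∷σ⊆ (proj₂ (proj₁ stopped))
      where
      ⊆μ∷σ : ∀ {v} → v ∈ X ∷ʳ μ → v ∈ μ ∷ σ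
      ⊆μ∷σ {v} v∈ with ∈-++⁻ X v∈
      ... | inj₂ (here refl) = here refl
      ... | inj₁ v∈X with μ ≟ v
      ...   | yes μ≡v = here (sym μ≡v)
      ...   | no μ≢v = there (∈-filter⁺ (∁? (μ ≟_)) v∈X μ≢v)
      μ∷σ⊆ : ∀ {v} → v ∈ μ ∷ σ → v ∈ X ∷ʳ μ
      μ∷σ⊆ (here refl) = ∈-++⁺ʳ X (here refl)
      μ∷σ⊆ (there v∈σ) = ∈-++⁺ˡ (proj₁ (∈-filter⁻ (∁? (μ ≟_)) {xs = X} v∈σ))

    fitsU = Fits-gapSplit μ downwardσ μ∉σ

  SplitStop-splitStop : SplitStop K₁ j′ (splitStop X μ)
  SplitStop-splitStop =
    (lenB , truesB) , length rL , z≤n , subst (length rL ≤_) lenU (subst (_≤ length bU) (proj₂ fitsU) (trues≤length bU)) ,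
    ((lenU , proj₂ fitsU) ,
     (refl , Downward-lowerPart μ downwardσ) , Sparse⇒¬Contains rL (Sparse-filter (_<? μ) σ sparseσ)) ,
    (lenRU , Downward-upperPart μ downwardσ μ∉σ) , Sparse⇒¬Contains rU (Sparse-upperPart μ downwardσ μ∉σ sparseσ)
    where
    open ≡-Reasoning
    sparseσ = Sparse-filter (∁? (μ ≟_)) X sparseX
    lenB : length bB ≡ j′
    lenB = trans (length-map _ X) (suc-injective (trans (sym (length-∷ʳ X μ)) (proj₁ (proj₁ stopped))))
    truesB : trues bB ≡ K₁
    truesB = trans (proj₂ fitsB) (trans (length-replicate (blockSize μ X)) blockSize-μ-X)
    lenU : length bU ≡ j′ ∸ K₁
    lenU = begin
      length bU            ≡⟨ length-map _ σ ⟩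
      length σ             ≡⟨ proj₁ fitsB ⟨
      falses bB            ≡⟨ falses≡length∸trues bB ⟩
      length bB ∸ trues bB ≡⟨ cong₂ _∸_ lenB truesB ⟩
      j′ ∸ K₁              ∎
    lenRU : length rU ≡ j′ ∸ K₁ ∸ length rL
    lenRU = begin
      length rU                                  ≡⟨ length-map (suc (height rL) +_) rU ⟨
      length (map (suc (height rL) +_) rU)       ≡⟨ proj₁ fitsU ⟨
      falses bU                                  ≡⟨ falses≡length∸trues bU ⟩
      length bU ∸ trues bU                       ≡⟨ cong₂ _∸_ lenU (proj₂ fitsU) ⟩
      j′ ∸ K₁ ∸ length rL                        ∎

  joinStop-splitStop : joinStop K₁ (splitStop X μ) ≡ X ∷ʳ μ
  joinStop-splitStop = begin
    riffle bB (gapJoin bU rL rU) (replicate K₁ (height rL)) ∷ʳ height rL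
      ≡⟨ cong₂ (λ s μ′ → riffle bB s (replicate K₁ μ′) ∷ʳ μ′) (gapJoin-gapSplit μ downwardσ μ∉σ) (height-lowerPart μ downwardσ) ⟩
    riffle bB σ (replicate K₁ μ) ∷ʳ μ
      ≡⟨ cong (λ t → riffle bB σ (replicate t μ) ∷ʳ μ) blockSize-μ-X ⟨
    riffle bB σ (replicate (blockSize μ X) μ) ∷ʳ μ
      ≡⟨ cong (_∷ʳ μ) (proj₂ (riffle-block μ X)) ⟩
    X ∷ʳ μ ∎
    where open ≡-Reasoning

stoppedCount : ℕ → (ℕ → ℕ) → ℕ → ℕ
stoppedCount K₁ a j = ((j ∸ 1) C K₁) * sumFromTo 0 (j ∸ suc K₁) (λ i → ((j ∸ suc K₁) C i) * a i * a (j ∸ suc K₁ ∸ i))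

card-Stopped : ∀ K₁ j′ (a : ℕ → ℕ) → (∀ m → Card′ (Avoid (suc K₁) m) (a m)) →
               Card′ (Stopped (suc K₁) (suc j′)) (stoppedCount K₁ a (suc j′))
card-Stopped K₁ j′ a cards =
  card-cong (sound , complete)
    (card-image (joinStop K₁) joinStop-injective
      (card-× (card-Mask j′ K₁)
        (card-⋃-range (SplitGap K₁ (j′ ∸ K₁)) (λ i → ((j′ ∸ K₁) C i) * a i * a (j′ ∸ K₁ ∸ i))
          (λ (((_ , #t) , _) , _) (((_ , #t′) , _) , _) → trans (sym #t) #t′) 0 (j′ ∸ K₁)
          (λ {i} _ _ → card-× (card-× (card-Mask (j′ ∸ K₁) i) (cards i)) (cards (j′ ∸ K₁ ∸ i))))))
  where
  sound : ∀ {r} → Σ StopData (λ p → SplitStop K₁ j′ p × r ≡ joinStop K₁ p) → Stopped (suc K₁) (suc j′) r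
  sound (p , split , refl) = Stopped-joinStop p split

  complete : ∀ {r} → Stopped (suc K₁) (suc j′) r → Σ StopData (λ p → SplitStop K₁ j′ p × r ≡ joinStop K₁ p)
  complete {r} stopped with initLast r
  complete stopped@((() , _) , _) | []
  ... | X ∷ʳ′ μ = splitStop X μ , SplitStop-splitStop X μ stopped , sym (joinStop-splitStop X μ stopped)

-- Leaves of the restricted generating tree

Contains⇒≤length : ∀ {K} r → Contains K r → K ≤ length r
Contains⇒≤length r (c , K≤) = ≤-trans K≤ (blockSize≤length c r)

card-Leaf-short : ∀ {K i} → i < K → Card (Leaf K i) (fubini i)
card-Leaf-short {K} {i} i<K = card-cong (inj₁ , avoid) (card-Avoid-fubini i i<K)
  where
  avoid : ∀ {r} → Leaf K i r → Avoid K i r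
  avoid (inj₁ av) = av
  avoid {r} (inj₂ (j , _ , j≤i , (len , _) , contains , _)) =
    ⊥-elim (<⇒≱ i<K (≤-trans (Contains⇒≤length r contains) (≤-trans (≤-reflexive len) j≤i)))

card-Leaf-long : ∀ K₁ n (a : ℕ → ℕ) → (∀ m → Card (Avoid (suc K₁) m) (a m)) → suc K₁ ≤ n →
                 ∀ {N} → Card (Avoid (suc K₁) n) N →
                 Card (Leaf (suc K₁) n)
                   (N + sumFromTo (suc K₁) n (stoppedCount K₁ a))
card-Leaf-long K₁ n a cards K≤n cardAvoid =
  card-cong ((Sum.map₂ λ (j , K≤j , j≤n , stopped) → j , ≤-trans (s≤s z≤n) K≤j , j≤n , stopped)
            , λ { (inj₁ avoid) → inj₁ avoid
                ; {r} (inj₂ (j , _ , j≤n , stopped@((len , _) , contains , _))) →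
                    inj₂ (j , subst (suc K₁ ≤_) len (Contains⇒≤length r contains) , j≤n , stopped) })
    (card-⊎ (λ (_ , ¬contains) (_ , _ , _ , (_ , contains , _)) → ¬contains contains)
      cardAvoid
      (card-⋃-range (Stopped (suc K₁)) (stoppedCount K₁ a)
        (λ ((len , _) , _) ((len′ , _) , _) → trans (sym len) len′) (suc K₁) n
        λ { {suc j′} _ _ → card-Stopped K₁ j′ a cards }))

theorem11 : (k : ℕ) → 2 ≤ k → (a : ℕ → ℕ) → (∀ m → Card (Avoid k m) (a m))
    → ((i : ℕ) → 1 ≤ i → i < k → Card (Leaf k i) (fubini i))
      × ((n : ℕ) → k ≤ n → Card (Leaf k n)
          (sumFromTo 1 (k ∸ 1) (λ i → (n C i) * a (n ∸ i))
           + sumFromTo k n (λ j → ((j ∸ 1) C (k ∸ 1))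
               * sumFromTo 0 (j ∸ k) (λ i → ((j ∸ k) C i) * a i * a (j ∸ k ∸ i)))))
-- The argument only needs k ≥ 1.
theorem11 (suc K₁) _ a cards =
  (λ i _ i<k → card-Leaf-short i<k) ,
  (λ n k≤n → card-Leaf-long K₁ n a cards k≤n
               (card-Avoid-recurrence K₁ a (≤-trans (s≤s z≤n) k≤n) (λ _ i≤K₁ → s≤s i≤K₁) (λ _ i<k → ≤-pred i<k) (λ {i} _ _ → cards (n ∸ i))))
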